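{- Let $n \ge 1$ and let $\mathcal{A}$ be a family of subsets of $[n]=\{1,\dots,n\}$ that is $i$-compressed for every $i \in [n]$. Then one of the following holds: (i) $\mathcal{A}$ is an initial segment of the level-colex order on $\mathcal{P}([n])$; (ii) $n = 2r+1$ is odd and $\mathcal{A} = \big([n]^{(\le r)} \setminus \{\{r+2, r+3, \ldots, n\}\}\big) \cup \{\{1,2,\ldots,r+1\}\}$; (iii) $n = 2r$ is even and $\mathcal{A} = \Big([n]^{(<r)} \cup \{A \in [n]^{(r)} : n \notin A\}\Big) \setminus \{\{r, r+1, \ldots, n-1\}\} \cup \{\{1,2,\ldots,r-1,n\}\}$.
   Context: For a finite totally ordered set $X$, the level-colex order on the power set $\mathcal{P}(X)$ is the total order in which $A < B$ if either $|A|<|B|$, or $|A|=|B|$ and $\max(A \triangle B) \in B$. $[n]^{(\le r)}$ (resp. $[n]^{(<r)}$, $[n]^{(r)}$) denotes the family of subsets of $[n]$ of size at most $r$ (resp. less than $r$, exactly $r$). For $\mathcal{A} \subseteq \mathcal{P}([n])$ and $i\in[n]$, the $i$-sections of $\mathcal{A}$ are the families on $[n]\setminus\{i\}$ given by $\mathcal{A}_{i- } = \{A \subseteq [n]\setminus\{i\} : A \in \mathcal{A}\}$ and $\mathcal{A}_{i+} = \{A \subseteq [n]\setminus\{i\} : A \cup \{i\} \in \mathcal{A}\}$. The $i$-compression $C_i(\mathcal{A})$ is the family on $[n]$ whose $i+$ section is the set of the first $|\mathcal{A}_{i+}|$ elements of the level-colex order on $\mathcal{P}([n]\setminus\{i\})$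 and whose $i-$ section is the set of the first $|\mathcal{A}_{i- }|$ elements of that order. $\mathcal{A}$ is $i$-compressed if $C_i(\mathcal{A}) = \mathcal{A}$. -}

module Defs where

open import Data.Nat using (ℕ; zero; suc; _+_; _*_; _<ᵇ_; _≡ᵇ_; _≤ᵇ_; _<_; _≤_)
open import Data.Bool using (Bool; true; false; not; _∧_; _∨_; if_then_else_; T)
import Data.Bool.Properties as BoolP
open import Data.Fin using (Fin; toℕ)
open import Data.Fin.Subset using (Subset; ∣_∣; _∈_; _∉_)
open import Data.Vec using (Vec; []; _∷_; tabulate; insertAt; removeAt; lookup)
open import Data.Vec.Properties using (≡-dec)
open import Data.List using (List; []; _∷_; _++_; map; length; filterᵇ)
open import Relation.Nullary.Decidable using (isYes)

-- Subsets of [n] = {1,…,n} are 'Subset n' (Vec Bool n); index j : Fin n stands for element toℕ j + 1.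

_=ˢ_ : ∀ {n} → Subset n → Subset n → Bool
A =ˢ B = isYes (≡-dec BoolP._≟_ A B)

-- colex A B  =  (A ≠ B and max(A △ B) ∈ B).
-- Larger elements sit further along the vector, so compare tails first.
colex : ∀ {n} → Subset n → Subset n → Bool
colex []      []      = false
colex (x ∷ A) (y ∷ B) = if A =ˢ B then (not x ∧ y) else colex A B

_<L_ : ∀ {n} → Subset n → Subset n → Bool
A <L B = (∣ A ∣ <ᵇ ∣ B ∣) ∨ ((∣ A ∣ ≡ᵇ ∣ B ∣) ∧ colex A B)

Family : ℕ → Set
Family n = Subset n → Bool

allSubsets : (n : ℕ) → List (Subset n)
allSubsets zero    = [] ∷ []
allSubsets (suc n) = map (false ∷_) (allSubsets n) ++ map (true ∷_) (allSubsets n)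

size : ∀ {n} → Family n → ℕ
size {n} 𝒜 = length (filterᵇ 𝒜 (allSubsets n))

rank : ∀ {n} → Subset n → ℕ
rank B = size (λ C → C <L B)

firstL : ∀ {n} → ℕ → Family n
firstL k B = rank B <ᵇ k

-- Sections along i. [n+1] \ {i} is identified with [n] order-preservingly
-- (via insertAt / removeAt), which is all the level-colex order depends on.
section- : ∀ {n} → Fin (suc n) → Family (suc n) → Family n
section- i 𝒜 B = 𝒜 (insertAt B i false)

section+ : ∀ {n} → Fin (suc n) → Family (suc n) → Family n
section+ i 𝒜 B = 𝒜 (insertAt B i true)

compress : ∀ {n} → Fin (suc n) → Family (suc n) → Family (suc n)
compress i 𝒜 A =
  if lookup A i
  then firstL (size (section+ i 𝒜)) (removeAt A i)
  else firstL (size (section- i 𝒜)) (removeAt A i)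

IsCompressed : ∀ {n} → Fin (suc n) → Family (suc n) → Set
IsCompressed i 𝒜 = ∀ A → compress i 𝒜 A ≡ 𝒜 A
  where open import Relation.Binary.PropositionalEquality using (_≡_)

IsInitialSegment : ∀ {n} → Family n → Set
IsInitialSegment 𝒜 = ∀ A B → T (B <L A) → T (𝒜 A) → T (𝒜 B)

⟦_∣_⟧ : (n : ℕ) → (ℕ → Bool) → Subset n
⟦ n ∣ p ⟧ = tabulate (λ j → p (suc (toℕ j)))

module Submission where

-- If A ∈ 𝒜, B ∉ 𝒜 and B precedes A in the level-colex order, then B and A
-- differ in every coordinate i: otherwise removing i keeps them in the same
-- order inside one i-section, which compression makes an initial segment, so
-- B ∈ 𝒜. Hence every such violating pair is (A, ∁ A), which pins 𝒜 down as
-- the level-colex initial segment up to A with ∁ A removed, ∁ A being the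
-- immediate predecessor of A. If |∁ A| < |A|, A is the first set of its level,
-- {1,…,r+1} with n = 2r+1. If |∁ A| = |A|, the two sets are told apart by
-- their largest coordinate n, so n ∈ A, n = 2r, and A = {1,…,r−1,n}.

open import Defs
open import Data.Bool using (Bool; true; false; T; not; _∧_; _∨_; T?)
open import Data.Bool.Properties
  using (_≟_; T-∨; T-∧; T-≡; ¬-not; not-¬; not-injective; ∨-identityʳ; ∨-zeroʳ)
open import Data.Nat
  using (ℕ; zero; suc; _+_; _*_; _<_; _≤_; _<ᵇ_; _≤ᵇ_; _≡ᵇ_; z≤n; s≤s; s≤s⁻¹; s<s⁻¹)
open import Data.Nat.Properties
  using ( <-irrefl; <-trans; ≤-trans; ≤-refl; ≤-reflexive; ≤-<-trans; <-cmp; suc-injective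
        ; n≤1+n; <ᵇ⇒<; <⇒<ᵇ; ≡ᵇ⇒≡; ≡⇒≡ᵇ; m≤n⇒m<n∨m≡n; m∸n+n≡m; +-comm; +-suc; +-identityʳ)
open import Data.Fin using (Fin; zero; suc; fromℕ; toℕ)
open import Data.Fin.Properties using (toℕ<n)
open import Data.Fin.Subset using (Subset; ∣_∣; _∈_; _∉_; ∁)
open import Data.Fin.Subset.Properties using (anySubset?; ∣p∣≤n; ∣∁p∣≡n∸∣p∣; x∈p⇒x∉∁p)
open import Data.Vec
  using ([]; _∷_; here; there; lookup; removeAt; insertAt; tabulate; _∷ʳ_; initLast)
open import Data.Vec.Properties
  using ( ≡-dec; ∷-injective; ∷ʳ-injective; map-∷ʳ; lookup-map
        ; tabulate∘lookup; tabulate-cong; tabulate-∘)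
open import Data.List.Relation.Binary.Sublist.Propositional using (⊆-refl)
open import Data.List.Relation.Binary.Sublist.Propositional.Properties
  using (filter⁺; length-mono-≤)
open import Data.Product as Product using (Σ; _×_; _,_)
open import Data.Product.Function.NonDependent.Propositional using (_×-⇔_)
open import Data.Sum as Sum using (_⊎_; inj₁; inj₂)
open import Data.Sum.Function.Propositional using (_⊎-⇔_)
open import Data.Empty using (⊥-elim)
open import Data.Unit using (tt)
open import Function using (_∘_; id)
open import Function.Bundles using (_⇔_; mk⇔; Equivalence)
open import Function.Construct.Identity using (⇔-id)
open import Function.Construct.Composition using (_⇔-∘_)
open import Relation.Nullary using (¬_; yes; no)
open import Relation.Nullary.Decidable using (decidable-stable; _×-dec_; ¬?)
open import Relation.Binary.Definitions using (tri<; tri≈; tri>)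
open import Relation.Binary.PropositionalEquality
  using (_≡_; _≢_; refl; sym; trans; cong; cong₂; subst; subst₂; module ≡-Reasoning)

open Equivalence using (to; from)

-- The tail of a vector holds the larger elements, so the decisive
-- coordinate max (A △ B) of Colex A B is the last one where A and B differ.

data Colex : ∀ {n} → Subset n → Subset n → Set where
  here  : ∀ {n} {A : Subset n} → Colex (false ∷ A) (true ∷ A)
  there : ∀ {n} {A B : Subset n} {x y} → Colex A B → Colex (x ∷ A) (y ∷ B)

Colex-irrefl : ∀ {n} {A : Subset n} → ¬ Colex A A
Colex-irrefl (there c) = Colex-irrefl c

Colex-trans : ∀ {n} {A B C : Subset n} → Colex A B → Colex B C → Colex A C
Colex-trans here      (there c) = there c
Colex-trans (there c) here      = there c
Colex-trans (there c) (there d) = there (Colex-trans c d)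

Colex-asym : ∀ {n} {A B : Subset n} → Colex A B → ¬ Colex B A
Colex-asym c d = Colex-irrefl (Colex-trans c d)

Colex-tri : ∀ {n} (A B : Subset n) → A ≡ B ⊎ Colex A B ⊎ Colex B A
Colex-tri [] [] = inj₁ refl
Colex-tri (x ∷ A) (y ∷ B) with Colex-tri A B
... | inj₂ (inj₁ c) = inj₂ (inj₁ (there c))
... | inj₂ (inj₂ c) = inj₂ (inj₂ (there c))
Colex-tri (false ∷ A) (false ∷ .A) | inj₁ refl = inj₁ refl
Colex-tri (false ∷ A) (true  ∷ .A) | inj₁ refl = inj₂ (inj₁ here)
Colex-tri (true  ∷ A) (false ∷ .A) | inj₁ refl = inj₂ (inj₂ here)
Colex-tri (true  ∷ A) (true  ∷ .A) | inj₁ refl = inj₁ refl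

Colex-∷⁻ : ∀ {n} {A B : Subset n} {a b} →
           Colex (a ∷ A) (b ∷ B) → (a ≡ false × b ≡ true × A ≡ B) ⊎ Colex A B
Colex-∷⁻ here      = inj₁ (refl , refl , refl)
Colex-∷⁻ (there c) = inj₂ c

colex-sound : ∀ {n} (A B : Subset n) → T (colex A B) → Colex A B
colex-sound [] [] ()
colex-sound (x ∷ A) (y ∷ B) t with ≡-dec _≟_ A B
colex-sound (false ∷ A) (true  ∷ .A) t  | yes refl = here
colex-sound (false ∷ A) (false ∷ .A) () | yes refl
colex-sound (true  ∷ A) (_     ∷ .A) () | yes refl
... | no _ = there (colex-sound A B t)

colex-complete : ∀ {n} {A B : Subset n} → Colex A B → T (colex A B)
colex-complete {A = false ∷ A} here with ≡-dec _≟_ A A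
... | yes _   = tt
... | no  A≢A = ⊥-elim (A≢A refl)
colex-complete {A = _ ∷ A} {_ ∷ B} (there c) with ≡-dec _≟_ A B
... | yes refl = ⊥-elim (Colex-irrefl c)
... | no  _    = colex-complete c

infix 4 _≺_ _⋖_

_≺_ : ∀ {n} → Subset n → Subset n → Set
A ≺ B = ∣ A ∣ < ∣ B ∣ ⊎ (∣ A ∣ ≡ ∣ B ∣ × Colex A B)

_⋖_ : ∀ {n} → Subset n → Subset n → Set
B ⋖ A = B ≺ A × (∀ C → B ≺ C → ¬ C ≺ A)

≺-irrefl : ∀ {n} {A : Subset n} → ¬ A ≺ A
≺-irrefl (inj₁ A<A)      = <-irrefl refl A<A
≺-irrefl (inj₂ (_ , c)) = Colex-irrefl c

≺-trans : ∀ {n} {A B C : Subset n} → A ≺ B → B ≺ C → A ≺ C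
≺-trans (inj₁ p)       (inj₁ q)       = inj₁ (<-trans p q)
≺-trans (inj₁ p)       (inj₂ (q , _)) = inj₁ (subst (_ <_) q p)
≺-trans (inj₂ (p , _)) (inj₁ q)       = inj₁ (subst (_< _) (sym p) q)
≺-trans (inj₂ (p , c)) (inj₂ (q , d)) = inj₂ (trans p q , Colex-trans c d)

≺-tri : ∀ {n} (A B : Subset n) → A ≡ B ⊎ A ≺ B ⊎ B ≺ A
≺-tri A B with <-cmp ∣ A ∣ ∣ B ∣
... | tri< A<B _ _ = inj₂ (inj₁ (inj₁ A<B))
... | tri> _ _ B<A = inj₂ (inj₂ (inj₁ B<A))
... | tri≈ _ same _ with Colex-tri A B
...   | inj₁ A≡B      = inj₁ A≡B
...   | inj₂ (inj₁ c) = inj₂ (inj₁ (inj₂ (same , c)))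
...   | inj₂ (inj₂ c) = inj₂ (inj₂ (inj₂ (sym same , c)))

<L-sound : ∀ {n} (A B : Subset n) → T (A <L B) → A ≺ B
<L-sound A B =
  Sum.map (<ᵇ⇒< _ _) (Product.map (≡ᵇ⇒≡ _ _) (colex-sound A B) ∘ to T-∧) ∘ to T-∨

<L-complete : ∀ {n} {A B : Subset n} → A ≺ B → T (A <L B)
<L-complete = from T-∨ ∘ Sum.map <⇒<ᵇ λ (same , c) → from T-∧ (≡⇒≡ᵇ _ _ same , colex-complete c)

rank-mono : ∀ {n} {X Y : Subset n} → X ≺ Y → rank X ≤ rank Y
rank-mono {n} {X} {Y} X≺Y =
  length-mono-≤ (filter⁺ (T? ∘ (_<L X)) (T? ∘ (_<L Y))
    (λ { {C} refl C<X → <L-complete (≺-trans (<L-sound C X C<X) X≺Y) }) (⊆-refl {x = allSubsets n}))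

firstL-downward : ∀ {n k} {X Y : Subset n} → X ≺ Y → T (firstL k Y) → T (firstL k X)
firstL-downward {k = k} {X} {Y} X≺Y Y∈ = <⇒<ᵇ (≤-<-trans (rank-mono X≺Y) (<ᵇ⇒< (rank Y) k Y∈))

∣removeAt∣ : ∀ {n} (A : Subset (suc n)) i → ∣ A ∣ ≡ ∣ lookup A i ∷ removeAt A i ∣
∣removeAt∣ (_ ∷ A) zero = refl
∣removeAt∣ (false ∷ A@(_ ∷ _)) (suc i) = ∣removeAt∣ A i
∣removeAt∣ (true ∷ A@(_ ∷ _)) (suc i) with lookup A i | ∣removeAt∣ A i
... | false | e = cong suc e
... | true  | e = cong suc e

∣∷∣-cancel-< : ∀ {n} b {X Y : Subset n} → ∣ b ∷ X ∣ < ∣ b ∷ Y ∣ → ∣ X ∣ < ∣ Y ∣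
∣∷∣-cancel-< true  = s<s⁻¹
∣∷∣-cancel-< false = id

∣∷∣-cancel-≡ : ∀ {n} b {X Y : Subset n} → ∣ b ∷ X ∣ ≡ ∣ b ∷ Y ∣ → ∣ X ∣ ≡ ∣ Y ∣
∣∷∣-cancel-≡ true  = suc-injective
∣∷∣-cancel-≡ false = id

Colex-removeAt : ∀ {n} {A B : Subset (suc n)} i →
                 lookup A i ≡ lookup B i → Colex A B → Colex (removeAt A i) (removeAt B i)
Colex-removeAt zero () here
Colex-removeAt zero _  (there c) = c
Colex-removeAt {A = false ∷ _ ∷ _} (suc i) _ here = here
Colex-removeAt {A = _ ∷ _ ∷ _} {_ ∷ _ ∷ _} (suc i) e (there c) = there (Colex-removeAt i e c)

≺-removeAt : ∀ {n} {A B : Subset (suc n)} i →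
             lookup A i ≡ lookup B i → A ≺ B → removeAt A i ≺ removeAt B i
≺-removeAt {A = A} {B} i same =
  Sum.map smaller (Product.map sameSize (Colex-removeAt i same))
  where
    b = lookup B i
    ∣A∣ : ∣ A ∣ ≡ ∣ b ∷ removeAt A i ∣
    ∣A∣ = trans (∣removeAt∣ A i) (cong (λ x → ∣ x ∷ removeAt A i ∣) same)
    smaller : ∣ A ∣ < ∣ B ∣ → ∣ removeAt A i ∣ < ∣ removeAt B i ∣
    smaller = ∣∷∣-cancel-< b {removeAt A i} {removeAt B i} ∘ subst₂ _<_ ∣A∣ (∣removeAt∣ B i)
    sameSize : ∣ A ∣ ≡ ∣ B ∣ → ∣ removeAt A i ∣ ≡ ∣ removeAt B i ∣
    sameSize e =
      ∣∷∣-cancel-≡ b {removeAt A i} {removeAt B i} (trans (sym ∣A∣) (trans e (∣removeAt∣ B i)))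

compress-firstL : ∀ {n} i (𝒜 : Family (suc n)) X →
  compress i 𝒜 X ≡ firstL (size (λ Y → 𝒜 (insertAt Y i (lookup X i)))) (removeAt X i)
compress-firstL i 𝒜 X with lookup X i
... | true  = refl
... | false = refl

∁-injective : ∀ {n} {A B : Subset n} → ∁ A ≡ ∁ B → A ≡ B
∁-injective {A = []}    {[]}    _ = refl
∁-injective {A = _ ∷ _} {_ ∷ _} e with ∷-injective e
... | head , tail = cong₂ _∷_ (not-injective head) (∁-injective tail)

∣∁p∣+∣p∣≡n : ∀ {n} (A : Subset n) → ∣ ∁ A ∣ + ∣ A ∣ ≡ n
∣∁p∣+∣p∣≡n A = trans (cong (_+ ∣ A ∣) (∣∁p∣≡n∸∣p∣ A)) (m∸n+n≡m (∣p∣≤n A))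

module _ {n} {𝒜 : Family (suc n)} (compressed : ∀ i → IsCompressed i 𝒜) where

  compressed-downward : ∀ {A B} i → lookup B i ≡ lookup A i → B ≺ A → T (𝒜 A) → T (𝒜 B)
  compressed-downward {A} {B} i same B≺A A∈ = subst T (sym (𝒜≡firstL B)) B∈section
    where
      sectionSize : Bool → ℕ
      sectionSize b = size (λ Y → 𝒜 (insertAt Y i b))
      𝒜≡firstL : ∀ X → 𝒜 X ≡ firstL (sectionSize (lookup X i)) (removeAt X i)
      𝒜≡firstL X = trans (sym (compressed i X)) (compress-firstL i 𝒜 X)
      B∈section : T (firstL (sectionSize (lookup B i)) (removeAt B i))
      B∈section = subst (λ b → T (firstL (sectionSize b) (removeAt B i))) (sym same)
        (firstL-downward {k = sectionSize (lookup A i)} (≺-removeAt i same B≺A)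
          (subst T (𝒜≡firstL A) A∈))

  violation⇒∁ : ∀ {A B} → T (𝒜 A) → ¬ T (𝒜 B) → B ≺ A → B ≡ ∁ A
  violation⇒∁ {A} {B} A∈ B∉ B≺A = begin
    B                       ≡⟨ tabulate∘lookup B ⟨
    tabulate (lookup B)     ≡⟨ tabulate-cong differ ⟩
    tabulate (lookup (∁ A)) ≡⟨ tabulate∘lookup (∁ A) ⟩
    ∁ A                     ∎
    where
      open ≡-Reasoning
      differ : ∀ i → lookup B i ≡ lookup (∁ A) i
      differ i = trans (¬-not (λ same → B∉ (compressed-downward i same B≺A A∈)))
                       (sym (lookup-map i not A))

  violation-members : ∀ {A B} → T (𝒜 A) → ¬ T (𝒜 B) → B ≺ A →
                      ∀ C → T (𝒜 C) ⇔ ((C ≺ A × C ≢ B) ⊎ C ≡ A)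
  violation-members {A} {B} A∈ B∉ B≺A C = mk⇔ members⇒ ⇒members
    where
      B≡∁A = violation⇒∁ A∈ B∉ B≺A
      members⇒ : T (𝒜 C) → (C ≺ A × C ≢ B) ⊎ C ≡ A
      members⇒ C∈ with ≺-tri C A
      ... | inj₁ C≡A        = inj₂ C≡A
      ... | inj₂ (inj₁ C≺A) = inj₁ (C≺A , λ { refl → B∉ C∈ })
      ... | inj₂ (inj₂ A≺C) = ⊥-elim (≺-irrefl (subst (A ≺_) C≡A A≺C))
        where C≡A = ∁-injective (trans (sym (violation⇒∁ C∈ B∉ (≺-trans B≺A A≺C))) B≡∁A)
      ⇒members : (C ≺ A × C ≢ B) ⊎ C ≡ A → T (𝒜 C)
      ⇒members (inj₂ refl) = A∈
      ⇒members (inj₁ (C≺A , C≢B)) = decidable-stable (T? (𝒜 C))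
        λ C∉ → C≢B (trans (violation⇒∁ A∈ C∉ C≺A) (sym B≡∁A))

  violation-covered : ∀ {A B} → T (𝒜 A) → ¬ T (𝒜 B) → B ≺ A → B ⋖ A
  violation-covered {A} {B} A∈ B∉ B≺A = B≺A , between
    where
      between : ∀ C → B ≺ C → ¬ C ≺ A
      between C B≺C C≺A = ≺-irrefl (subst (_≺ A) C≡A C≺A)
        where
          C∈ = from (violation-members A∈ B∉ B≺A C)
                    (inj₁ (C≺A , λ { refl → ≺-irrefl B≺C }))
          C≡A = ∁-injective (trans (sym (violation⇒∁ C∈ B∉ B≺C)) (violation⇒∁ A∈ B∉ B≺A))

prefix : ∀ n → ℕ → Subset n
prefix zero    _       = []
prefix (suc n) zero    = false ∷ prefix n zero
prefix (suc n) (suc k) = true ∷ prefix n k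

∣prefix∣ : ∀ {n k} → k ≤ n → ∣ prefix n k ∣ ≡ k
∣prefix∣ {zero}  z≤n       = refl
∣prefix∣ {suc n} z≤n       = ∣prefix∣ {n} z≤n
∣prefix∣ {suc n} (s≤s k≤n) = cong suc (∣prefix∣ k≤n)

∣prefix∣≤ : ∀ n k → ∣ prefix n k ∣ ≤ k
∣prefix∣≤ zero    k       = z≤n
∣prefix∣≤ (suc n) zero    = ∣prefix∣≤ n zero
∣prefix∣≤ (suc n) (suc k) = s≤s (∣prefix∣≤ n k)

prefix-colex-least : ∀ {n} k (X : Subset n) → k ≤ ∣ X ∣ → X ≢ prefix n k → Colex (prefix n k) X
prefix-colex-least k [] _ X≢P = ⊥-elim (X≢P refl)
prefix-colex-least zero (false ∷ X) _ X≢P =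
  there (prefix-colex-least zero X z≤n (X≢P ∘ cong (false ∷_)))
prefix-colex-least {suc n} zero (true ∷ X) _ _ with ≡-dec _≟_ X (prefix n zero)
... | yes refl = here
... | no  X≢P  = there (prefix-colex-least zero X z≤n X≢P)
prefix-colex-least (suc k) (true ∷ X) (s≤s k≤X) X≢P =
  there (prefix-colex-least k X k≤X (X≢P ∘ cong (true ∷_)))
prefix-colex-least {suc n} (suc k) (false ∷ X) k<X _ =
  there (prefix-colex-least k X (≤-trans (n≤1+n k) k<X) X≢P)
  where
    X≢P : X ≢ prefix n k
    X≢P refl = <-irrefl refl (≤-trans k<X (∣prefix∣≤ n k))

≺-prefix : ∀ {n k} → k ≤ n → (C : Subset n) → C ≺ prefix n k ⇔ ∣ C ∣ < k
≺-prefix {n} {k} k≤n C = mk⇔ ≺P⇒ (inj₁ ∘ subst (∣ C ∣ <_) (sym ∣P∣))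
  where
    ∣P∣ = ∣prefix∣ k≤n
    ≺P⇒ : C ≺ prefix n k → ∣ C ∣ < k
    ≺P⇒ (inj₁ smaller)     = subst (∣ C ∣ <_) ∣P∣ smaller
    ≺P⇒ (inj₂ (same , C⊏P)) = ⊥-elim (Colex-asym C⊏P
      (prefix-colex-least k C (≤-reflexive (sym (trans same ∣P∣))) λ { refl → Colex-irrefl C⊏P }))

⋖-between-levels : ∀ {n} {A B : Subset n} → B ⋖ A → ∣ B ∣ < ∣ A ∣ → A ≡ prefix n (suc ∣ B ∣)
⋖-between-levels {n} {A} {B} (_ , between) B<A =
  decidable-stable (≡-dec _≟_ A P) λ A≢P → between P B≺P (P≺A A≢P)
  where
    P = prefix n (suc ∣ B ∣)
    ∣P∣ : ∣ P ∣ ≡ suc ∣ B ∣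
    ∣P∣ = ∣prefix∣ (≤-trans B<A (∣p∣≤n A))
    B≺P : B ≺ P
    B≺P = inj₁ (subst (∣ B ∣ <_) (sym ∣P∣) ≤-refl)
    P≺A : A ≢ P → P ≺ A
    P≺A A≢P with m≤n⇒m<n∨m≡n B<A
    ... | inj₁ smaller = inj₁ (subst (_< ∣ A ∣) (sym ∣P∣) smaller)
    ... | inj₂ same    =
      inj₂ (trans ∣P∣ same , prefix-colex-least (suc ∣ B ∣) A (≤-reflexive same) A≢P)

∣∷ʳ∣ : ∀ {n} (X : Subset n) x → ∣ X ∷ʳ x ∣ ≡ ∣ x ∷ X ∣
∣∷ʳ∣ []          _     = refl
∣∷ʳ∣ (false ∷ X) x     = ∣∷ʳ∣ X x
∣∷ʳ∣ (true  ∷ X) false = cong suc (∣∷ʳ∣ X false)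
∣∷ʳ∣ (true  ∷ X) true  = cong suc (∣∷ʳ∣ X true)

last∈ : ∀ {n} (X : Subset n) → fromℕ n ∈ X ∷ʳ true
last∈ []      = here
last∈ (_ ∷ X) = there (last∈ X)

last∉ : ∀ {n} (X : Subset n) → fromℕ n ∉ X ∷ʳ false
last∉ []      ()
last∉ (_ ∷ X) (there n∈X) = last∉ X n∈X

Colex-∷ʳ : ∀ {n} {A B : Subset n} x → Colex A B → Colex (A ∷ʳ x) (B ∷ʳ x)
Colex-∷ʳ x here      = here
Colex-∷ʳ x (there c) = there (Colex-∷ʳ x c)

Colex-∷ʳ-last : ∀ {n} (A B : Subset n) → Colex (A ∷ʳ false) (B ∷ʳ true)
Colex-∷ʳ-last []      []      = here
Colex-∷ʳ-last (_ ∷ A) (_ ∷ B) = there (Colex-∷ʳ-last A B)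

Colex-∷ʳ⁻ : ∀ {n} (A B : Subset n) {x y} →
            Colex (A ∷ʳ x) (B ∷ʳ y) → (x ≡ false × y ≡ true) ⊎ (x ≡ y × Colex A B)
Colex-∷ʳ⁻ [] [] c with Colex-∷⁻ c
... | inj₁ (refl , refl , _) = inj₁ (refl , refl)
... | inj₂ ()
Colex-∷ʳ⁻ (_ ∷ A) (_ ∷ B) c with Colex-∷⁻ c
... | inj₂ c′ = Sum.map₂ (Product.map₂ there) (Colex-∷ʳ⁻ A B c′)
... | inj₁ (refl , refl , same) with ∷ʳ-injective A B same
...   | refl , refl = inj₂ (refl , here)

Colex-∁-∷ʳ : ∀ {n} (A : Subset n) a → Colex (∁ (A ∷ʳ a)) (A ∷ʳ a) → a ≡ true
Colex-∁-∷ʳ A a c with Colex-∷ʳ⁻ (∁ A) A (subst (λ X → Colex X (A ∷ʳ a)) (map-∷ʳ not a A) c)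
... | inj₁ (_ , a≡true)  = a≡true
... | inj₂ (not-a≡a , _) = ⊥-elim (not-¬ refl (sym not-a≡a))

≺-prefix∷ʳ : ∀ {n k} → k ≤ n → (C : Subset (suc n)) →
             C ≺ prefix n k ∷ʳ true ⇔ (∣ C ∣ < suc k ⊎ (∣ C ∣ ≡ suc k × fromℕ n ∉ C))
≺-prefix∷ʳ {n} {k} k≤n C with initLast C
... | C′ , c , refl = mk⇔ ≺Q⇒ ⇒≺Q
  where
    P = prefix n k
    ∣Q∣ : ∣ P ∷ʳ true ∣ ≡ suc k
    ∣Q∣ = trans (∣∷ʳ∣ P true) (cong suc (∣prefix∣ k≤n))
    ≺Q⇒ : C′ ∷ʳ c ≺ P ∷ʳ true → ∣ C′ ∷ʳ c ∣ < suc k ⊎ (∣ C′ ∷ʳ c ∣ ≡ suc k × fromℕ n ∉ C′ ∷ʳ c)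
    ≺Q⇒ (inj₁ smaller) = inj₁ (subst (_ <_) ∣Q∣ smaller)
    ≺Q⇒ (inj₂ (same , col)) with Colex-∷ʳ⁻ C′ P col
    ... | inj₁ (refl , _) = inj₂ (trans same ∣Q∣ , last∉ C′)
    ... | inj₂ (refl , C′⊏P) = ⊥-elim (Colex-asym C′⊏P
      (prefix-colex-least k C′ (≤-reflexive (sym ∣C′∣)) λ { refl → Colex-irrefl C′⊏P }))
      where
        ∣C′∣ : ∣ C′ ∣ ≡ k
        ∣C′∣ = suc-injective (trans (sym (∣∷ʳ∣ C′ true)) (trans same ∣Q∣))
    ⇒≺Q : ∣ C′ ∷ʳ c ∣ < suc k ⊎ (∣ C′ ∷ʳ c ∣ ≡ suc k × fromℕ n ∉ C′ ∷ʳ c) → C′ ∷ʳ c ≺ P ∷ʳ true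
    ⇒≺Q (inj₁ smaller) = inj₁ (subst (_ <_) (sym ∣Q∣) smaller)
    ⇒≺Q (inj₂ (same , n∉C)) =
      inj₂ ( trans same (sym ∣Q∣)
           , subst (λ b → Colex (C′ ∷ʳ b) (P ∷ʳ true)) (sym c≡false) (Colex-∷ʳ-last C′ P))
      where
        c≡false : c ≡ false
        c≡false = ¬-not λ c≡true → n∉C (subst (λ b → fromℕ n ∈ C′ ∷ʳ b) (sym c≡true) (last∈ C′))

⋖-within-level : ∀ {n} {A : Subset n} {B : Subset (suc n)} →
             B ⋖ A ∷ʳ true → ∣ B ∣ ≡ ∣ A ∷ʳ true ∣ → fromℕ n ∉ B → A ≡ prefix n ∣ A ∣
⋖-within-level {n} {A} {B} (_ , between) same n∉B =
  decidable-stable (≡-dec _≟_ A P) λ A≢P → between (P ∷ʳ true) B≺Q (Q≺A A≢P)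
  where
    P = prefix n ∣ A ∣
    ∣P∣ = ∣prefix∣ (∣p∣≤n A)
    B≺Q : B ≺ P ∷ʳ true
    B≺Q = from (≺-prefix∷ʳ (∣p∣≤n A) B) (inj₂ (trans same (∣∷ʳ∣ A true) , n∉B))
    Q≺A : A ≢ P → P ∷ʳ true ≺ A ∷ʳ true
    Q≺A A≢P = inj₂ ( trans (∣∷ʳ∣ P true) (trans (cong suc ∣P∣) (sym (∣∷ʳ∣ A true)))
                   , Colex-∷ʳ true (prefix-colex-least ∣ A ∣ A ≤-refl A≢P))

prefix≡⟦⟧ : ∀ n k → prefix n k ≡ ⟦ n ∣ (λ x → x ≤ᵇ k) ⟧
prefix≡⟦⟧ zero    _       = refl
prefix≡⟦⟧ (suc n) zero    = cong (false ∷_) (prefix≡⟦⟧ n zero)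
prefix≡⟦⟧ (suc n) (suc k) = cong (true ∷_) (prefix≡⟦⟧ n k)

∁⟦⟧ : ∀ n (p : ℕ → Bool) → ∁ ⟦ n ∣ p ⟧ ≡ ⟦ n ∣ (λ x → not (p x)) ⟧
∁⟦⟧ n p = sym (tabulate-∘ not _)

⟦⟧-cong : ∀ n (p q : ℕ → Bool) → (∀ x → x < n → p (suc x) ≡ q (suc x)) → ⟦ n ∣ p ⟧ ≡ ⟦ n ∣ q ⟧
⟦⟧-cong n p q eq = tabulate-cong (λ j → eq (toℕ j) (toℕ<n j))

⟦⟧-∷ʳ : ∀ n (p : ℕ → Bool) → ⟦ suc n ∣ p ⟧ ≡ ⟦ n ∣ p ⟧ ∷ʳ p (suc n)
⟦⟧-∷ʳ zero    p = refl
⟦⟧-∷ʳ (suc n) p = cong (p 1 ∷_) (⟦⟧-∷ʳ n (λ x → p (suc x)))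

not-<ᵇ : ∀ m n → not (m <ᵇ n) ≡ (n <ᵇ suc m)
not-<ᵇ m       zero    = refl
not-<ᵇ zero    (suc n) = refl
not-<ᵇ (suc m) (suc n) = not-<ᵇ m n

not-≡ᵇ : ∀ {m n} → m ≤ n → not (m ≡ᵇ n) ≡ (m <ᵇ n)
not-≡ᵇ {zero}  {zero}  _         = refl
not-≡ᵇ {zero}  {suc n} _         = refl
not-≡ᵇ {suc m} {suc n} (s≤s m≤n) = not-≡ᵇ m≤n

≡ᵇ-false : ∀ {m n} → m < n → (m ≡ᵇ n) ≡ false
≡ᵇ-false {zero}  {suc n} _         = refl
≡ᵇ-false {suc m} {suc n} (s≤s m<n) = ≡ᵇ-false m<n

not-∨ : ∀ x y → not (x ∨ y) ≡ not x ∧ not y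
not-∨ true  _ = refl
not-∨ false _ = refl

odd-bottom : ∀ n r → ⟦ n ∣ (λ x → x ≤ᵇ (r + 1)) ⟧ ≡ prefix n (suc r)
odd-bottom n r =
  trans (cong (λ k → ⟦ n ∣ (λ x → x ≤ᵇ k) ⟧) (+-comm r 1)) (sym (prefix≡⟦⟧ n (suc r)))

odd-top : ∀ n r → ⟦ n ∣ (λ x → (r + 2) ≤ᵇ x) ⟧ ≡ ∁ (prefix n (suc r))
odd-top n r = begin
  ⟦ n ∣ q ⟧                  ≡⟨ ⟦⟧-cong n q (λ x → not (p x)) pointwise ⟩
  ⟦ n ∣ (λ x → not (p x)) ⟧  ≡⟨ ∁⟦⟧ n p ⟨
  ∁ ⟦ n ∣ p ⟧                ≡⟨ cong ∁ (prefix≡⟦⟧ n (suc r)) ⟨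
  ∁ (prefix n (suc r))       ∎
  where
    open ≡-Reasoning
    p q : ℕ → Bool
    p x = x ≤ᵇ suc r
    q x = (r + 2) ≤ᵇ x
    pointwise : ∀ x → x < n → (r + 2 ≤ᵇ suc x) ≡ not (suc x ≤ᵇ suc r)
    pointwise x _ = trans (cong (_≤ᵇ suc x) (+-comm r 2)) (sym (not-<ᵇ x (suc r)))

even-bottom : ∀ m k → ⟦ suc m ∣ (λ x → (x <ᵇ suc k) ∨ (x ≡ᵇ suc m)) ⟧ ≡ prefix m k ∷ʳ true
even-bottom m k = begin
  ⟦ suc m ∣ p ⟧                    ≡⟨ ⟦⟧-∷ʳ m p ⟩
  ⟦ m ∣ p ⟧ ∷ʳ p (suc m)           ≡⟨ cong₂ _∷ʳ_ (⟦⟧-cong m p (λ x → x ≤ᵇ k) below) last ⟩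
  ⟦ m ∣ (λ x → x ≤ᵇ k) ⟧ ∷ʳ true  ≡⟨ cong (_∷ʳ true) (prefix≡⟦⟧ m k) ⟨
  prefix m k ∷ʳ true               ∎
  where
    open ≡-Reasoning
    p : ℕ → Bool
    p x = (x <ᵇ suc k) ∨ (x ≡ᵇ suc m)
    below : ∀ x → x < m → p (suc x) ≡ (suc x ≤ᵇ k)
    below x x<m = trans (cong ((x <ᵇ k) ∨_) (≡ᵇ-false x<m)) (∨-identityʳ _)
    last : p (suc m) ≡ true
    last = trans (cong ((m <ᵇ k) ∨_) (to T-≡ (≡⇒≡ᵇ m m refl))) (∨-zeroʳ _)

even-top : ∀ m k → ⟦ suc m ∣ (λ x → (suc k ≤ᵇ x) ∧ (x <ᵇ suc m)) ⟧ ≡ ∁ (prefix m k ∷ʳ true)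
even-top m k = begin
  ⟦ suc m ∣ q ⟧                  ≡⟨ ⟦⟧-cong (suc m) q (λ x → not (p x)) pointwise ⟩
  ⟦ suc m ∣ (λ x → not (p x)) ⟧  ≡⟨ ∁⟦⟧ (suc m) p ⟨
  ∁ ⟦ suc m ∣ p ⟧                ≡⟨ cong ∁ (even-bottom m k) ⟩
  ∁ (prefix m k ∷ʳ true)         ∎
  where
    open ≡-Reasoning
    p q : ℕ → Bool
    p x = (x <ᵇ suc k) ∨ (x ≡ᵇ suc m)
    q x = (suc k ≤ᵇ x) ∧ (x <ᵇ suc m)
    pointwise : ∀ x → x < suc m → (suc k ≤ᵇ suc x) ∧ (suc x <ᵇ suc m) ≡ not (p (suc x))
    pointwise x x≤m =
      sym (trans (not-∨ (x <ᵇ k) _) (cong₂ _∧_ (not-<ᵇ x k) (not-≡ᵇ (s≤s⁻¹ x≤m))))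

OddException : (m : ℕ) → Family (suc m) → Set
OddException m 𝒜 =
  Σ ℕ λ r → (suc m ≡ 2 * r + 1)
    × ((A : Subset (suc m)) →
         T (𝒜 A) ⇔ (((∣ A ∣ ≤ r) × (A ≢ ⟦ suc m ∣ (λ x → (r + 2) ≤ᵇ x) ⟧))
                    ⊎ (A ≡ ⟦ suc m ∣ (λ x → x ≤ᵇ (r + 1)) ⟧)))

EvenException : (m : ℕ) → Family (suc m) → Set
EvenException m 𝒜 =
  Σ ℕ λ r → (suc m ≡ 2 * r)
    × ((A : Subset (suc m)) →
         T (𝒜 A) ⇔ ((((∣ A ∣ < r) ⊎ ((∣ A ∣ ≡ r) × (fromℕ m ∉ A)))
                     × (A ≢ ⟦ suc m ∣ (λ x → (r ≤ᵇ x) ∧ (x <ᵇ suc m)) ⟧))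
                    ⊎ (A ≡ ⟦ suc m ∣ (λ x → (x <ᵇ r) ∨ (x ≡ᵇ suc m)) ⟧)))

family-shape : ∀ {n} {𝒜 : Family n} {A B Bot Top : Subset n} {P : Subset n → Set} →
  (∀ C → T (𝒜 C) ⇔ ((C ≺ A × C ≢ B) ⊎ C ≡ A)) → A ≡ Bot → B ≡ Top → (∀ C → C ≺ A ⇔ P C) →
  ∀ C → T (𝒜 C) ⇔ ((P C × C ≢ Top) ⊎ C ≡ Bot)
family-shape members refl refl P⇔ C = ((P⇔ C ×-⇔ ⇔-id _) ⊎-⇔ ⇔-id _) ⇔-∘ members C

odd-exception : ∀ {m} {𝒜 : Family (suc m)} → (∀ i → IsCompressed i 𝒜) →
  ∀ {A} → T (𝒜 A) → ¬ T (𝒜 (∁ A)) → ∣ ∁ A ∣ < ∣ A ∣ → OddException m 𝒜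
odd-exception {m} compressed {A} A∈ ∁A∉ smaller =
  r , dimension , family-shape members A≡bottom ∁A≡top ≺A
  where
    open ≡-Reasoning
    r = ∣ ∁ A ∣
    members = violation-members compressed A∈ ∁A∉ (inj₁ smaller)
    r<1+m : suc r ≤ suc m
    r<1+m = ≤-trans smaller (∣p∣≤n A)
    A≡P : A ≡ prefix (suc m) (suc r)
    A≡P = ⋖-between-levels (violation-covered compressed A∈ ∁A∉ (inj₁ smaller)) smaller
    dimension : suc m ≡ 2 * r + 1
    dimension = begin
      suc m        ≡⟨ ∣∁p∣+∣p∣≡n A ⟨
      r + ∣ A ∣     ≡⟨ cong (r +_) (trans (cong ∣_∣ A≡P) (∣prefix∣ r<1+m)) ⟩
      r + suc r    ≡⟨ +-suc r r ⟩
      suc (r + r)  ≡⟨ cong (λ t → suc (r + t)) (+-identityʳ r) ⟨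
      1 + 2 * r    ≡⟨ +-comm 1 (2 * r) ⟩
      2 * r + 1    ∎
    A≡bottom : A ≡ ⟦ suc m ∣ (λ x → x ≤ᵇ (r + 1)) ⟧
    A≡bottom = trans A≡P (sym (odd-bottom (suc m) r))
    ∁A≡top : ∁ A ≡ ⟦ suc m ∣ (λ x → (r + 2) ≤ᵇ x) ⟧
    ∁A≡top = trans (cong ∁ A≡P) (sym (odd-top (suc m) r))
    ≺A : ∀ C → C ≺ A ⇔ ∣ C ∣ ≤ r
    ≺A C = mk⇔ s≤s⁻¹ s≤s ⇔-∘ subst (λ X → C ≺ X ⇔ ∣ C ∣ < suc r) (sym A≡P) (≺-prefix r<1+m C)

even-exception : ∀ {m} {𝒜 : Family (suc m)} → (∀ i → IsCompressed i 𝒜) →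
  ∀ {A} → T (𝒜 A) → ¬ T (𝒜 (∁ A)) → ∣ ∁ A ∣ ≡ ∣ A ∣ → Colex (∁ A) A → EvenException m 𝒜
even-exception {m} compressed {A} A∈ ∁A∉ same c with initLast A
... | A′ , a , refl with Colex-∁-∷ʳ A′ a c
... | refl = suc k , dimension , family-shape members A≡bottom ∁A≡top ≺A
  where
    open ≡-Reasoning
    k = ∣ A′ ∣
    ∁A≺A : ∁ (A′ ∷ʳ true) ≺ A′ ∷ʳ true
    ∁A≺A = inj₂ (same , c)
    members = violation-members compressed A∈ ∁A∉ ∁A≺A
    A≡P : A′ ∷ʳ true ≡ prefix m k ∷ʳ true
    A≡P = cong (_∷ʳ true)
      (⋖-within-level (violation-covered compressed A∈ ∁A∉ ∁A≺A) same (x∈p⇒x∉∁p (last∈ A′)))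
    ∣A∣ : ∣ A′ ∷ʳ true ∣ ≡ suc k
    ∣A∣ = ∣∷ʳ∣ A′ true
    dimension : suc m ≡ 2 * suc k
    dimension = begin
      suc m                               ≡⟨ ∣∁p∣+∣p∣≡n (A′ ∷ʳ true) ⟨
      ∣ ∁ (A′ ∷ʳ true) ∣ + ∣ A′ ∷ʳ true ∣ ≡⟨ cong₂ _+_ (trans same ∣A∣) ∣A∣ ⟩
      suc k + suc k                       ≡⟨ cong (suc k +_) (+-identityʳ (suc k)) ⟨
      2 * suc k                           ∎
    A≡bottom : A′ ∷ʳ true ≡ ⟦ suc m ∣ (λ x → (x <ᵇ suc k) ∨ (x ≡ᵇ suc m)) ⟧
    A≡bottom = trans A≡P (sym (even-bottom m k))
    ∁A≡top : ∁ (A′ ∷ʳ true) ≡ ⟦ suc m ∣ (λ x → (suc k ≤ᵇ x) ∧ (x <ᵇ suc m)) ⟧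
    ∁A≡top = trans (cong ∁ A≡P) (sym (even-top m k))
    Below : Subset (suc m) → Set
    Below C = ∣ C ∣ < suc k ⊎ (∣ C ∣ ≡ suc k × fromℕ m ∉ C)
    ≺A : ∀ C → C ≺ A′ ∷ʳ true ⇔ Below C
    ≺A C = subst (λ X → C ≺ X ⇔ Below C) (sym A≡P) (≺-prefix∷ʳ (∣p∣≤n A′) C)

lemma2 : (m : ℕ) (𝒜 : Family (suc m))
    → ((i : Fin (suc m)) → IsCompressed i 𝒜)
    → IsInitialSegment 𝒜
      ⊎ (Σ ℕ λ r → (suc m ≡ 2 * r + 1)
           × ((A : Subset (suc m)) →
                T (𝒜 A) ⇔ (((∣ A ∣ ≤ r) × (A ≢ ⟦ suc m ∣ (λ x → (r + 2) ≤ᵇ x) ⟧))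
                           ⊎ (A ≡ ⟦ suc m ∣ (λ x → x ≤ᵇ (r + 1)) ⟧))))
      ⊎ (Σ ℕ λ r → (suc m ≡ 2 * r)
           × ((A : Subset (suc m)) →
                T (𝒜 A) ⇔ ((((∣ A ∣ < r) ⊎ ((∣ A ∣ ≡ r) × (fromℕ m ∉ A)))
                             × (A ≢ ⟦ suc m ∣ (λ x → (r ≤ᵇ x) ∧ (x <ᵇ suc m)) ⟧))
                           ⊎ (A ≡ ⟦ suc m ∣ (λ x → (x <ᵇ r) ∨ (x ≡ᵇ suc m)) ⟧))))
lemma2 m 𝒜 compressed
  with anySubset? (λ A → anySubset? λ B → T? (B <L A) ×-dec T? (𝒜 A) ×-dec ¬? (T? (𝒜 B)))
... | no noViolation = inj₁ λ A B B<A A∈ →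
  decidable-stable (T? (𝒜 B)) λ B∉ → noViolation (A , B , B<A , A∈ , B∉)
... | yes (A , B , B<A , A∈ , B∉)
  with violation⇒∁ compressed A∈ B∉ (<L-sound B A B<A) | <L-sound B A B<A
... | refl | inj₁ smaller     = inj₂ (inj₁ (odd-exception compressed A∈ B∉ smaller))
... | refl | inj₂ (same , c) = inj₂ (inj₂ (even-exception compressed A∈ B∉ same c))
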